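{- Let $(s\,|\,c)$ and $(s\,|\,d)$ be $l$-multipartition data with $d_i-c_i\equiv d_j-c_j\pmod s$ for all $i,j$ (where congruence modulo $0$ means equality). Then $\mathcal{C}_{(s|c)}=\mathcal{C}_{(s|d)}$.
   Context: An $l$-multipartition is an $l$-tuple of partitions, with nodes $(a,b,k)$ for $b\le\lambda^{(k)}_a$. An $l$-multipartition datum is $(s\,|\,c)$ with $s\in\{0,1,2,\dots\}$, $c\in\mathbb{Z}^l$. The $(s\,|\,c)$-residue of $(a,b,k)$ is $b-a+c_k+s\mathbb{Z}$ (the integer $b-a+c_k$ if $s=0$); the content is the multiset of residues of the nodes; $\lambda$ is an $(s\,|\,c)$-core if no other $l$-multipartition has the same content, except that for $s=1$ the only $(1\,|\,c)$-core is $(\varnothing,\dots,\varnothing)$. $\mathcal{C}_{(s|c)}$ is the set of $(s\,|\,c)$-cores. -}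

module Defs where

open import Data.Nat as ℕ using (ℕ; zero; suc; _≥_)
open import Data.Integer as ℤ using (ℤ; +_; _%ℕ_)
open import Data.Fin using (Fin)
open import Data.List using (List; []; _∷_; _++_; concatMap; map; allFin)
open import Data.List.Relation.Unary.All using (All)
open import Data.List.Relation.Binary.Permutation.Propositional using (_↭_)
open import Data.Product using (_×_)
open import Relation.Binary.PropositionalEquality using (_≡_)

data Decreasing : List ℕ → Set where
  dec-[]  : Decreasing []
  dec-[x] : ∀ {x} → Decreasing (x ∷ [])
  dec-∷   : ∀ {x y ys} → x ≥ y → Decreasing (y ∷ ys) → Decreasing (x ∷ y ∷ ys)

IsPartition : List ℕ → Set
IsPartition xs = All (λ x → x ≥ 1) xs × Decreasing xs

MultiPartition : ℕ → Set
MultiPartition l = Fin l → List ℕ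

IsMultipartition : ∀ {l} → MultiPartition l → Set
IsMultipartition {l} λs = ∀ (k : Fin l) → IsPartition (λs k)

_≋_ : ∀ {l} → MultiPartition l → MultiPartition l → Set
_≋_ {l} λs μs = ∀ (k : Fin l) → λs k ≡ μs k

-- Residue of an integer in ℤ/sℤ, represented canonically:
-- for s = 0 the integer itself, for s > 0 its remainder in [0, s).
residue : ℕ → ℤ → ℤ
residue zero    x = x
residue (suc s) x = + (x %ℕ suc s)

oneTo : ℕ → List ℕ
oneTo zero    = []
oneTo (suc n) = oneTo n ++ (suc n ∷ [])

-- b - a + c for the node in row a, column b (a, b ≥ 1)
rawRes : ℕ → ℕ → ℤ → ℤ
rawRes a b c = ((+ b) ℤ.- (+ a)) ℤ.+ c

rowsRes : ℕ → ℕ → ℤ → List ℕ → List ℤ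
rowsRes s a c []       = []
rowsRes s a c (r ∷ rs) =
  map (λ b → residue s (rawRes a b c)) (oneTo r) ++ rowsRes s (suc a) c rs

-- The (s | c)-content of a multipartition, as a list of residues
-- (a multiset, i.e. considered up to permutation).
content : ∀ {l} → ℕ → (Fin l → ℤ) → MultiPartition l → List ℤ
content {l} s c λs = concatMap (λ k → rowsRes s 1 (c k) (λs k)) (allFin l)

SameContent : ∀ {l} → ℕ → (Fin l → ℤ) → MultiPartition l → MultiPartition l → Set
SameContent s c λs μs = content s c λs ↭ content s c μs

IsCore : ∀ {l} → ℕ → (Fin l → ℤ) → MultiPartition l → Set
IsCore {l} (suc zero) c λs = ∀ (k : Fin l) → λs k ≡ []
IsCore {l} s          c λs =
  IsMultipartition λs ×
  (∀ (μs : MultiPartition l) → IsMultipartition μs →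
     SameContent s c λs μs → μs ≋ λs)

-- Shifting every charge c_k by the same t modulo s replaces the residue x of
-- each node by x + t modulo s, so the (s | d)-content of any multipartition is
-- the image of its (s | c)-content under one fixed map, and conversely with -t.
-- Equality of contents is therefore the same relation for c and for d, and the
-- core condition only compares contents.
module Submission where

open import Defs
open import Data.Nat using (ℕ)
open import Data.Integer using (ℤ; _-_)
open import Data.Fin using (Fin)
open import Relation.Binary.PropositionalEquality using (_≡_)
open import Function.Bundles using (_⇔_)

open import Data.Nat as ℕ using (zero; suc)
import Data.Fin as Fin
import Data.Nat.Properties as ℕ
import Data.Nat.Divisibility as ℕ
open import Data.Integer using (+_; _+_; _*_; -_; 0ℤ; ∣_∣; _%ℕ_; _/ℕ_)
open import Data.Integer.Properties
  using (∣i∣≡0⇒i≡0; i-j≡0⇒i≡j; +-inverseʳ; m-n≡m⊖n; ∣m⊝n∣≤m⊔n)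
open import Data.Integer.DivMod using (a≡a%ℕn+[a/ℕn]*n; n%ℕd<d)
open import Data.Integer.Divisibility.Signed
  using (_∣_; divides; ∣⇒∣ᵤ; 0∣⇒≡0; ∣m∣n⇒∣m+n; ∣m∣n⇒∣m-n; ∣m⇒∣-m)
open import Data.Integer.Tactic.RingSolver using (solve-∀)
open import Data.Product using (Σ; _,_)
open import Data.Product.Function.NonDependent.Propositional using (_×-⇔_)
open import Data.List using (List; []; _∷_; _++_; map; allFin)
import Data.List.Properties as List
open import Data.List.Relation.Binary.Permutation.Propositional.Properties
  using (map⁺)
open import Data.List.Relation.Binary.Permutation.Propositional using (_↭_)
open import Function.Bundles using (mk⇔; module Equivalence)
import Function.Properties.Equivalence as ⇔
open import Relation.Nullary using (contradiction)
open import Relation.Binary.PropositionalEquality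
  using (refl; sym; trans; cong; cong₂; subst; subst₂; module ≡-Reasoning)

∣∧<⇒≡0 : ∀ {m n} → m ℕ.∣ n → n ℕ.< m → n ≡ 0
∣∧<⇒≡0 {n = zero}  _   _   = refl
∣∧<⇒≡0 {n = suc n} m∣n n<m = contradiction (ℕ.∣⇒≤ m∣n) (ℕ.<⇒≱ n<m)

∣-residue : ∀ s x → + s ∣ x - residue s x
∣-residue zero    x = divides 0ℤ (+-inverseʳ x)
∣-residue (suc m) x = divides (x /ℕ suc m) (begin
  x - + r                      ≡⟨ cong (_- + r) (a≡a%ℕn+[a/ℕn]*n x (suc m)) ⟩
  (+ r + q * + suc m) - + r    ≡⟨ cancel (+ r) q (+ suc m) ⟩
  q * + suc m                  ∎)
  where
  open ≡-Reasoning
  r = x %ℕ suc m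
  q = x /ℕ suc m
  cancel : ∀ r q n → (r + q * n) - r ≡ q * n
  cancel = solve-∀

residue-canonical : ∀ s x y → + s ∣ residue s x - residue s y →
                    residue s x ≡ residue s y
residue-canonical zero    x y s∣ = i-j≡0⇒i≡j x y (0∣⇒≡0 s∣)
residue-canonical (suc m) x y s∣ =
  i-j≡0⇒i≡j (+ r) (+ r′) (∣i∣≡0⇒i≡0 (∣∧<⇒≡0 (∣⇒∣ᵤ s∣) ∣r-r′∣<s))
  where
  r  = x %ℕ suc m
  r′ = y %ℕ suc m
  ∣r-r′∣<s : ∣ + r - + r′ ∣ ℕ.< suc m
  ∣r-r′∣<s = subst (ℕ._< suc m) (cong ∣_∣ (sym (m-n≡m⊖n r r′)))
    (ℕ.≤-<-trans (∣m⊝n∣≤m⊔n r r′)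
      (ℕ.⊔-lub (n%ℕd<d x (suc m)) (n%ℕd<d y (suc m))))

residue-≡⇔∣ : ∀ s x y → (residue s x ≡ residue s y) ⇔ (+ s ∣ x - y)
residue-≡⇔∣ s x y = mk⇔ to from
  where
  via-residue : ∀ x y u → x - y ≡ (x - u) - (y - u)
  via-residue = solve-∀
  residues-via : ∀ x y a b → a - b ≡ (x - y) - ((x - a) - (y - b))
  residues-via = solve-∀
  to : residue s x ≡ residue s y → + s ∣ x - y
  to eq = subst (+ s ∣_) (sym (via-residue x y (residue s y)))
    (∣m∣n⇒∣m-n (subst (λ u → + s ∣ x - u) eq (∣-residue s x)) (∣-residue s y))
  from : + s ∣ x - y → residue s x ≡ residue s y
  from s∣ = residue-canonical s x y
    (subst (+ s ∣_) (sym (residues-via x y (residue s x) (residue s y)))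
      (∣m∣n⇒∣m-n s∣ (∣m∣n⇒∣m-n (∣-residue s x) (∣-residue s y))))

-- Congruence modulo s as divisibility by + s, which for s = 0 is equality.
ShiftedBy : ∀ {l} → ℕ → ℤ → (c d : Fin l → ℤ) → Set
ShiftedBy s t c d = ∀ k → + s ∣ (d k - c k) - t

ShiftedBy-sym : ∀ {l s t} {c d : Fin l → ℤ} →
                ShiftedBy s t c d → ShiftedBy s (- t) d c
ShiftedBy-sym {s = s} {t} {c} {d} sh k =
  subst (+ s ∣_) (neg-swap (d k) (c k) t) (∣m⇒∣-m (sh k))
  where
  neg-swap : ∀ d c t → - ((d - c) - t) ≡ (c - d) - (- t)
  neg-swap = solve-∀

ShiftedBy-common : ∀ {l} s (c d : Fin l → ℤ) →
                   (∀ i j → residue s (d i - c i) ≡ residue s (d j - c j)) →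
                   Σ ℤ λ t → ShiftedBy s t c d
ShiftedBy-common {zero}  s c d h = 0ℤ , λ ()
ShiftedBy-common {suc l} s c d h =
  d Fin.zero - c Fin.zero , λ k → Equivalence.to (residue-≡⇔∣ s _ _) (h k Fin.zero)

shiftResidue : ℕ → ℤ → ℤ → ℤ
shiftResidue s t x = residue s (x + t)

residue-shift : ∀ s y {c d t} → + s ∣ (d - c) - t →
                residue s (y + d) ≡ shiftResidue s t (residue s (y + c))
residue-shift s y {c} {d} {t} s∣ = Equivalence.from (residue-≡⇔∣ s _ _)
  (subst (+ s ∣_) (sym (regroup y c d t (residue s (y + c))))
    (∣m∣n⇒∣m+n (∣-residue s (y + c)) s∣))
  where
  regroup : ∀ y c d t u → (y + d) - (u + t) ≡ ((y + c) - u) + ((d - c) - t)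
  regroup = solve-∀

rowsRes-shift : ∀ {s c d t} → + s ∣ (d - c) - t → ∀ a rs →
                rowsRes s a d rs ≡ map (shiftResidue s t) (rowsRes s a c rs)
rowsRes-shift s∣ a []       = refl
rowsRes-shift {s} {c} {d} {t} s∣ a (r ∷ rs) = begin
  nodes d ++ rowsRes s (suc a) d rs
    ≡⟨ cong₂ _++_ nodes-shift (rowsRes-shift s∣ (suc a) rs) ⟩
  map f (nodes c) ++ map f (rowsRes s (suc a) c rs)
    ≡⟨ List.map-++ f (nodes c) (rowsRes s (suc a) c rs) ⟨
  map f (rowsRes s a c (r ∷ rs)) ∎
  where
  open ≡-Reasoning
  f = shiftResidue s t
  nodes : ℤ → List ℤ
  nodes e = map (λ b → residue s (rawRes a b e)) (oneTo r)
  nodes-shift : nodes d ≡ map f (nodes c)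
  nodes-shift = trans (List.map-cong (λ b → residue-shift s (+ b - + a) s∣) (oneTo r))
                      (List.map-∘ (oneTo r))

content-shift : ∀ {l s t} {c d : Fin l → ℤ} → ShiftedBy s t c d → ∀ λs →
                content s d λs ≡ map (shiftResidue s t) (content s c λs)
content-shift {l} {s} {t} {c} sh λs =
  trans (List.concatMap-cong (λ k → rowsRes-shift (sh k) 1 (λs k)) (allFin l))
        (sym (List.map-concatMap (shiftResidue s t) rowsOf (allFin l)))
  where
  rowsOf : Fin l → List ℤ
  rowsOf k = rowsRes s 1 (c k) (λs k)

Rigid : ∀ {l} → ℕ → (Fin l → ℤ) → MultiPartition l → Set
Rigid {l} s c λs = ∀ (μs : MultiPartition l) → IsMultipartition μs →
                   SameContent s c λs μs → μs ≋ λs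

Rigid-transfer : ∀ {l s} {c d : Fin l → ℤ} (g : ℤ → ℤ) →
                 (∀ μs → content s c μs ≡ map g (content s d μs)) →
                 ∀ {λs} → Rigid s c λs → Rigid s d λs
Rigid-transfer g factors {λs} rigid μs μs-mp same =
  rigid μs μs-mp (subst₂ _↭_ (sym (factors λs)) (sym (factors μs)) (map⁺ g same))

Rigid-⇔ : ∀ {l} s (c d : Fin l → ℤ) →
          (∀ i j → residue s (d i - c i) ≡ residue s (d j - c j)) →
          ∀ λs → Rigid s c λs ⇔ Rigid s d λs
Rigid-⇔ s c d h λs with t , sh ← ShiftedBy-common s c d h = mk⇔
  (Rigid-transfer {s = s} {c} {d} (shiftResidue s (- t)) (content-shift sh⁻¹))
  (Rigid-transfer {s = s} {d} {c} (shiftResidue s t) (content-shift sh))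
  where
  sh⁻¹ : ShiftedBy s (- t) d c
  sh⁻¹ = ShiftedBy-sym {s = s} {t} {c} {d} sh

lemma2p3 : (l s : ℕ) (c d : Fin l → ℤ) →
    (∀ (i j : Fin l) → residue s (d i - c i) ≡ residue s (d j - c j)) →
    (λs : MultiPartition l) → IsMultipartition λs →
    (IsCore s c λs ⇔ IsCore s d λs)
lemma2p3 l zero          c d h λs _ = ⇔.refl ×-⇔ Rigid-⇔ zero c d h λs
lemma2p3 l (suc zero)    c d h λs _ = ⇔.refl
lemma2p3 l (suc (suc n)) c d h λs _ = ⇔.refl ×-⇔ Rigid-⇔ (suc (suc n)) c d h λs
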